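{- Let $c_1, c_2$ be rational numbers with $0 \le c_1, c_2 \le 1$, and let $G$ be a $(c_1,c_2)$-mixed graph with $n$ vertices. If $$\delta(G) \ge \frac{1}{2-c_1-c_2}\, n + \frac{2}{2-c_1-c_2}\cdot \frac{\ln n}{\ln \frac{4}{3}},$$ then $\overrightarrow{\mathrm{diam}}(G) = 2$.
   Context: A mixed graph $G$ has a finite vertex set $V(G)$ and an edge set $E(G)$ consisting of undirected edges $xy$ and directed edges (arcs) $\overrightarrow{xy}$; there are no loops and no parallel edges. For $x \in V(G)$: $N^+_G(x)=\{y : \overrightarrow{xy}\in E(G)\}$, $N^-_G(x)=\{y:\overrightarrow{yx}\in E(G)\}$, $N^0_G(x)=\{y: xy\in E(G)\}$, $N_G(x)=N^+_G(x)\cup N^-_G(x)\cup N^0_G(x)$; the degree is $d_G(x)=|N_G(x)|$, the out-degree $d^+_G(x)=|N^+_G(x)|$, the in-degree $d^-_G(x)=|N^-_G(x)|$, and $\delta(G)$ is the minimum degree. For rational numbers $0\le c_1,c_2\le 1$, $G$ is a $(c_1,c_2)$-mixed graph if $d^+_G(u)\le c_1 d_G(u)$ and $d^-_G(u)\le c_2 d_G(u)$ for every $u\in V(G)$. An orientation of $G$ is a directed graph obtained by assigning a direction to every undirected edge of $G$ (directed edges keep their direction). The oriented diameter $\overrightarrow{\mathrm{diam}}(G)$ is the minimum, over all strongly connected orientations $D$ of $G$, of the diameter of $D$ (the maximum over ordered pairs of distinct vertices $(u,v)$ of the length of a shortest directed path from $u$ to $v$ in $D$). -}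

module Defs where

open import Data.Nat as ℕ using (ℕ; zero; suc; _⊓_; _^_)
open import Data.Integer as ℤ using (ℤ; +_)
open import Data.Rational as ℚ using (ℚ; ↥_; ↧ₙ_; 0ℚ; 1ℚ; ½)
open import Data.Fin using (Fin; zero; suc)
open import Data.List using (List; map)
open import Data.Nat.ListAction using (sum)
open import Data.List using () renaming (allFin to allFinL)
open import Data.Bool using (Bool; true; false)
open import Data.Product using (Σ; ∃; _×_; _,_)
open import Relation.Binary.PropositionalEquality using (_≡_; _≢_)
open import Relation.Nullary using (¬_)

-- For an ordered pair (x , y), G x y records the (unique, since there are
-- no parallel edges) edge between x and y, seen from x:
--   none  : no edge
--   undir : undirected edge xy
--   out   : arc x → y
--   inn   : arc y → x

data EdgeKind : Set where
  none undir out inn : EdgeKind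

flipKind : EdgeKind → EdgeKind
flipKind none  = none
flipKind undir = undir
flipKind out   = inn
flipKind inn   = out

record MixedGraph (n : ℕ) : Set where
  field
    adj      : Fin n → Fin n → EdgeKind
    loopless : ∀ x → adj x x ≡ none
    coherent : ∀ x y → adj y x ≡ flipKind (adj x y)
open MixedGraph public

isNbr isOut isIn : EdgeKind → ℕ
isNbr none = 0
isNbr _    = 1
isOut out = 1
isOut _   = 0
isIn inn = 1
isIn _   = 0

countV : ∀ {n} → (Fin n → ℕ) → ℕ
countV {n} f = sum (map f (allFinL n))

deg degOut degIn : ∀ {n} → MixedGraph n → Fin n → ℕ
deg    G x = countV (λ y → isNbr (adj G x y))
degOut G x = countV (λ y → isOut (adj G x y))
degIn  G x = countV (λ y → isIn  (adj G x y))

minFin : ∀ {m} → (Fin (suc m) → ℕ) → ℕ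
minFin {zero}  f = f zero
minFin {suc m} f = f zero ⊓ minFin (λ i → f (suc i))

minDeg : ∀ {m} → MixedGraph (suc m) → ℕ
minDeg G = minFin (deg G)

toℚ : ℕ → ℚ
toℚ k = (+ k) ℚ./ 1

IsMixed : ∀ {n} → ℚ → ℚ → MixedGraph n → Set
IsMixed c₁ c₂ G = ∀ x →
  (toℚ (degOut G x) ℚ.≤ c₁ ℚ.* toℚ (deg G x)) ×
  (toℚ (degIn G x)  ℚ.≤ c₂ ℚ.* toℚ (deg G x))

-- The real inequality  ln n / ln (4/3) ≤ x  (n ≥ 1, x ∈ ℚ), expressed
-- exactly without reals: writing x = p/q in lowest terms (q > 0) it is
-- equivalent to  n ≤ (4/3)^(p/q), i.e. p ≥ 0 and 3^p · n^q ≤ 4^p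
-- (if p < 0 then (4/3)^(p/q) < 1 ≤ n, so the inequality fails).

Log43≤ : ℕ → ℚ → Set
Log43≤ n x = Σ ℕ λ p → (↥ x ≡ + p) × (3 ^ p ℕ.* n ^ (↧ₙ x) ℕ.≤ 4 ^ p)

Digraph : ℕ → Set
Digraph n = Fin n → Fin n → Bool

OrientOK : EdgeKind → Bool → Bool → Set
OrientOK none  a b = a ≡ false
OrientOK undir a b = a ≢ b
OrientOK out   a b = a ≡ true
OrientOK inn   a b = a ≡ false

IsOrientation : ∀ {n} → MixedGraph n → Digraph n → Set
IsOrientation G D = ∀ x y → OrientOK (adj G x y) (D x y) (D y x)

data Walk {n : ℕ} (D : Digraph n) : ℕ → Fin n → Fin n → Set where
  here : ∀ {u} → Walk D 0 u u
  step : ∀ {k u w v} → D u w ≡ true → Walk D k w v → Walk D (suc k) u v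

DistLE : ∀ {n} → Digraph n → ℕ → Fin n → Fin n → Set
DistLE D k u v = Σ ℕ λ j → (j ℕ.≤ k) × Walk D j u v

StronglyConnected : ∀ {n} → Digraph n → Set
StronglyConnected D = ∀ u v → Σ ℕ λ k → DistLE D k u v

DiamLE : ∀ {n} → Digraph n → ℕ → Set
DiamLE D k = ∀ u v → u ≢ v → DistLE D k u v

-- diam→(G) = d  for d ≥ 1: the minimum over strongly connected
-- orientations of the diameter equals d, i.e. some strongly connected
-- orientation has diameter ≤ d, and none has diameter ≤ d - 1.
OrientedDiamIs : ∀ {n} → MixedGraph n → ℕ → Set
OrientedDiamIs {n} G d =
  (Σ (Digraph n) λ D → IsOrientation G D × StronglyConnected D × DiamLE D d) ×
  (∀ (D : Digraph n) → IsOrientation G D → StronglyConnected D →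
     ¬ DiamLE D (d ℕ.∸ 1))

{-# OPTIONS --safe #-}
module Submission where

-- Orient every undirected edge independently and uniformly at random; arcs keep their
-- direction.  For distinct u, v call w a route if uw may be oriented u → w and wv may be
-- oriented w → v.  Each route becomes a path u → w → v with probability at least 1/4,
-- independently for different w, so u and v stay unconnected within two steps with
-- probability at most (3/4)^K, where K is the number of routes.  Counting neighbours,
-- K ≥ d(u) - d⁻(u) + d(v) - d⁺(v) - n ≥ (2 - c₁ - c₂) δ - n, which the degree hypothesis
-- turns into 3^K n² ≤ 4^K, strictly since 3 divides the left side (when K > 0) but not the
-- right.  So (3/4)^K < 1/n², and a union bound over the ordered pairs leaves an orientation
-- of diameter at most 2, and no orientation has diameter 1 since that would need arcs
-- in both directions between two vertices.  Probabilities are replaced throughout by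
-- counts over all 2^(n·n) bit vectors driving the random orientation.

open import Defs

-- The first block works in ℕ, the second in ℚ; their operator names would clash.

module _ where

  open import Algebra.Properties.CommutativeSemigroup as CommutativeSemigroup using ()
  open import Data.Bool using (Bool; true; false; not; _∧_; T)
  open import Data.Bool.Properties using (not-involutive; not-¬; T-∧; ∧-zeroʳ)
  open import Data.Empty using (⊥; ⊥-elim)
  open import Data.Fin as Fin using (Fin; zero; suc; combine)
  import Data.Fin.Properties as Fin
  open import Data.List using (List; []; _∷_; map; length; allFin)
  open import Data.List.Membership.Propositional using (_∈_)
  open import Data.List.Membership.Propositional.Properties using (∈-allFin)
  open import Data.List.Properties using (length-tabulate)
  open import Data.List.Relation.Unary.All as All using (All; []; _∷_)
  open import Data.List.Relation.Unary.AllPairs using ([]; _∷_)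
  open import Data.List.Relation.Unary.Any using (here; there)
  open import Data.List.Relation.Unary.Unique.Propositional using (Unique)
  open import Data.List.Relation.Unary.Unique.Propositional.Properties using (allFin⁺)
  open import Data.Nat using (ℕ; zero; suc; _+_; _*_; _^_; _∸_; _≤_; _<_; z≤n; s≤s; pred; NonZero)
  open import Data.Nat.DivMod using (_%_; [m+kn]%n≡m%n; m*n%n≡0)
  open import Data.Nat.ListAction using (sum; product)
  open import Data.Nat.Properties
  open import Data.Nat.Tactic.RingSolver using (solve-∀)
  open import Data.Product using (∃; _×_; _,_; proj₁; proj₂)
  import Data.Product as Product
  open import Data.Sum using (_⊎_; inj₁; inj₂)
  import Data.Sum as Sum
  open import Data.Unit using (tt)
  open import Data.Vec.Functional as Vector using (Vector)
  open import Function using (_∘_; id)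
  open import Function.Bundles using (Equivalence)
  open import Relation.Binary using (Tri; tri<; tri≈; tri>)
  open import Relation.Binary.PropositionalEquality
  open import Relation.Nullary using (¬_; Dec; yes; no)
  open import Relation.Nullary.Decidable using (_⊎-dec_)

  open CommutativeSemigroup +-commutativeSemigroup using () renaming (interchange to +-interchange)
  module *-CS = CommutativeSemigroup *-commutativeSemigroup

  module _ {A : Set} where

    sum-map-+ : ∀ (f g : A → ℕ) xs → sum (map (λ x → f x + g x) xs) ≡ sum (map f xs) + sum (map g xs)
    sum-map-+ f g []       = refl
    sum-map-+ f g (x ∷ xs) = trans (cong (f x + g x +_) (sum-map-+ f g xs))
                                   (+-interchange (f x) (g x) (sum (map f xs)) (sum (map g xs)))

    sum-map-mono : ∀ {f g : A → ℕ} xs → (∀ x → f x ≤ g x) → sum (map f xs) ≤ sum (map g xs)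
    sum-map-mono []       f≤g = z≤n
    sum-map-mono (x ∷ xs) f≤g = +-mono-≤ (f≤g x) (sum-map-mono xs f≤g)

    sum-map-1 : ∀ (xs : List A) → sum (map (λ _ → 1) xs) ≡ length xs
    sum-map-1 []       = refl
    sum-map-1 (x ∷ xs) = cong suc (sum-map-1 xs)

    sum-map-*-≤ : ∀ {f : A → ℕ} {c t} xs → (∀ x → f x * c ≤ t) → sum (map f xs) * c ≤ length xs * t
    sum-map-*-≤             []       _    = z≤n
    sum-map-*-≤ {f} {c} {t} (x ∷ xs) fc≤t = begin
      (f x + sum (map f xs)) * c    ≡⟨ *-distribʳ-+ c (f x) (sum (map f xs)) ⟩
      f x * c + sum (map f xs) * c  ≤⟨ +-mono-≤ (fc≤t x) (sum-map-*-≤ xs fc≤t) ⟩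
      t + length xs * t             ∎
      where open ≤-Reasoning

    sum-map-≡0 : ∀ {f : A → ℕ} {x} xs → sum (map f xs) ≡ 0 → x ∈ xs → f x ≡ 0
    sum-map-≡0 {f} (y ∷ xs) Σ≡0 (here refl)  = m+n≡0⇒m≡0 (f y) Σ≡0
    sum-map-≡0 {f} (y ∷ xs) Σ≡0 (there x∈xs) = sum-map-≡0 xs (m+n≡0⇒n≡0 (f y) Σ≡0) x∈xs

    product-map-≡0 : ∀ {f : A → ℕ} xs → product (map f xs) ≡ 0 → ∃ λ x → f x ≡ 0
    product-map-≡0 {f} (x ∷ xs) Π≡0 with m*n≡0⇒m≡0∨n≡0 (f x) Π≡0
    ... | inj₁ fx≡0 = x , fx≡0
    ... | inj₂ Π≡0′ = product-map-≡0 xs Π≡0′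

  length-allFin : ∀ n → length (allFin n) ≡ n
  length-allFin n = length-tabulate id

  pred[n]<n : ∀ {n} .{{_ : NonZero n}} → pred n < n
  pred[n]<n {suc n} = ≤-refl

  minFin-≤ : ∀ {m} (f : Fin (suc m) → ℕ) i → minFin f ≤ f i
  minFin-≤ {zero}  f zero    = ≤-refl
  minFin-≤ {suc m} f zero    = m⊓n≤m _ _
  minFin-≤ {suc m} f (suc i) = ≤-trans (m⊓n≤n _ _) (minFin-≤ (λ j → f (suc j)) i)

  -- Sums over all Boolean vectors

  withHead : ∀ {A : Set} {N} → Bool → (Vector Bool (suc N) → A) → Vector Bool N → A
  withHead b f σ = f (b Vector.∷ σ)

  sumAll : ∀ N → (Vector Bool N → ℕ) → ℕ
  sumAll zero    f = f Vector.[]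
  sumAll (suc N) f = sumAll N (withHead true f) + sumAll N (withHead false f)

  sumAll-cong : ∀ {N} {f g : Vector Bool N → ℕ} → (∀ σ → f σ ≡ g σ) → sumAll N f ≡ sumAll N g
  sumAll-cong {zero}  f≗g = f≗g _
  sumAll-cong {suc N} f≗g =
    cong₂ _+_ (sumAll-cong (f≗g ∘ (true Vector.∷_))) (sumAll-cong (f≗g ∘ (false Vector.∷_)))

  sumAll-mono : ∀ {N} {f g : Vector Bool N → ℕ} → (∀ σ → f σ ≤ g σ) → sumAll N f ≤ sumAll N g
  sumAll-mono {zero}  f≤g = f≤g _
  sumAll-mono {suc N} f≤g =
    +-mono-≤ (sumAll-mono (f≤g ∘ (true Vector.∷_))) (sumAll-mono (f≤g ∘ (false Vector.∷_)))

  sumAll-+ : ∀ {N} (f g : Vector Bool N → ℕ) → sumAll N (λ σ → f σ + g σ) ≡ sumAll N f + sumAll N g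
  sumAll-+ {zero}  f g = refl
  sumAll-+ {suc N} f g =
    trans (cong₂ _+_ (sumAll-+ (withHead true f) (withHead true g)) (sumAll-+ (withHead false f) (withHead false g)))
          (+-interchange (sumAll N (withHead true f)) (sumAll N (withHead true g))
                         (sumAll N (withHead false f)) (sumAll N (withHead false g)))

  sumAll-const : ∀ N c → sumAll N (λ _ → c) ≡ c * 2 ^ N
  sumAll-const zero    c = sym (*-identityʳ c)
  sumAll-const (suc N) c = trans (cong₂ _+_ (sumAll-const N c) (sumAll-const N c)) (double c (2 ^ N))
    where
    double : ∀ c p → c * p + c * p ≡ c * (2 * p)
    double = solve-∀

  sumAll-sum : ∀ {A : Set} N (g : A → Vector Bool N → ℕ) xs →
               sumAll N (λ σ → sum (map (λ x → g x σ) xs)) ≡ sum (map (λ x → sumAll N (g x)) xs)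
  sumAll-sum N g []       = sumAll-const N 0
  sumAll-sum N g (x ∷ xs) =
    trans (sumAll-+ (g x) (λ σ → sum (map (λ y → g y σ) xs))) (cong (sumAll N (g x) +_) (sumAll-sum N g xs))

  sumAll-bit : ∀ {N} (i : Fin N) (h : Bool → ℕ) → sumAll N (λ σ → h (σ i)) * 2 ≡ (h true + h false) * 2 ^ N
  sumAll-bit {suc N} zero    h =
    trans (cong₂ (λ a b → (a + b) * 2) (sumAll-const N (h true)) (sumAll-const N (h false)))
          (factor (h true) (h false) (2 ^ N))
    where
    factor : ∀ a b p → (a * p + b * p) * 2 ≡ (a + b) * (2 * p)
    factor = solve-∀
  sumAll-bit {suc N} (suc i) h = begin
    (S + S) * 2                       ≡⟨ double S ⟩
    2 * (S * 2)                       ≡⟨ cong (2 *_) (sumAll-bit i h) ⟩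
    2 * ((h true + h false) * 2 ^ N)  ≡⟨ *-CS.x∙yz≈y∙xz 2 (h true + h false) (2 ^ N) ⟩
    (h true + h false) * 2 ^ suc N    ∎
    where
    open ≡-Reasoning
    S = sumAll N (λ σ → h (σ i))
    double : ∀ s → (s + s) * 2 ≡ 2 * (s * 2)
    double = solve-∀

  sumAll<⇒∃≡0 : ∀ N (f : Vector Bool N → ℕ) → sumAll N f < 2 ^ N → ∃ λ σ → f σ ≡ 0
  sumAll<⇒∃≡0 zero    f f[]<1 = Vector.[] , n<1⇒n≡0 f[]<1
  sumAll<⇒∃≡0 (suc N) f S<2P with sumAll N (withHead true f) <? 2 ^ N
  ... | yes Sᵗ<P = let σ , fσ≡0 = sumAll<⇒∃≡0 N (withHead true f) Sᵗ<P in true Vector.∷ σ , fσ≡0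
  ... | no  Sᵗ≮P = let σ , fσ≡0 = sumAll<⇒∃≡0 N (withHead false f) Sᶠ<P in false Vector.∷ σ , fσ≡0
    where
    Sᶠ<P : sumAll N (withHead false f) < 2 ^ N
    Sᶠ<P = +-cancelˡ-< (2 ^ N) _ _ (begin-strict
      2 ^ N + sumAll N (withHead false f)                       ≤⟨ +-monoˡ-≤ _ (≮⇒≥ Sᵗ≮P) ⟩
      sumAll N (withHead true f) + sumAll N (withHead false f)  <⟨ S<2P ⟩
      2 ^ N + (2 ^ N + 0)                                       ≡⟨ cong (2 ^ N +_) (+-identityʳ (2 ^ N)) ⟩
      2 ^ N + 2 ^ N                                             ∎)
      where open ≤-Reasoning

  Ignores : ∀ {A : Set} {N} → (Vector Bool N → A) → Fin N → Set
  Ignores f i = ∀ σ τ → (∀ j → j ≢ i → σ j ≡ τ j) → f σ ≡ f τ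

  Ignores-∘ : ∀ {A B : Set} {N} {f : Vector Bool N → A} {i} (h : A → B) → Ignores f i → Ignores (h ∘ f) i
  Ignores-∘ h f-ign σ τ σ≈τ = cong h (f-ign σ τ σ≈τ)

  Ignores-const : ∀ {A : Set} {N} {f : Vector Bool N → A} {c i} → (∀ σ → f σ ≡ c) → Ignores f i
  Ignores-const f≡c σ τ _ = trans (f≡c σ) (sym (f≡c τ))

  Ignores-product : ∀ {A : Set} {N} (f : A → Vector Bool N → ℕ) {i} xs → All (λ x → Ignores (f x) i) xs →
                    Ignores (λ σ → product (map (λ x → f x σ) xs)) i
  Ignores-product f []       []                 σ τ σ≈τ = refl
  Ignores-product f (x ∷ xs) (fx-ign ∷ fxs-ign) σ τ σ≈τ =
    cong₂ _*_ (fx-ign σ τ σ≈τ) (Ignores-product f xs fxs-ign σ τ σ≈τ)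

  Ignores-withHead : ∀ {A : Set} {N} {f : Vector Bool (suc N) → A} {i} b →
                     Ignores f (suc i) → Ignores (withHead b f) i
  Ignores-withHead b f-ign σ τ σ≈τ = f-ign (b Vector.∷ σ) (b Vector.∷ τ) λ
    { zero    _   → refl
    ; (suc j) j≢i → σ≈τ j (j≢i ∘ cong suc) }

  Ignores-zero⇒withHead : ∀ {A : Set} {N} {f : Vector Bool (suc N) → A} →
                          Ignores f zero → ∀ σ → withHead true f σ ≡ withHead false f σ
  Ignores-zero⇒withHead f-ign σ = f-ign (true Vector.∷ σ) (false Vector.∷ σ) λ
    { zero    0≢0 → ⊥-elim (0≢0 refl)
    ; (suc j) _   → refl }

  Independent : ∀ {N} → (f g : Vector Bool N → ℕ) → Set
  Independent f g = ∀ i → Ignores f i ⊎ Ignores g i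

  Independent-sym : ∀ {N} {f g : Vector Bool N → ℕ} → Independent f g → Independent g f
  Independent-sym f⊥g = Sum.swap ∘ f⊥g

  Independent-withHead : ∀ {N} {f g : Vector Bool (suc N) → ℕ} b c →
                         Independent f g → Independent (withHead b f) (withHead c g)
  Independent-withHead b c f⊥g i with f⊥g (suc i)
  ... | inj₁ f-ign = inj₁ (Ignores-withHead b f-ign)
  ... | inj₂ g-ign = inj₂ (Ignores-withHead c g-ign)

  mutual
    sumAll-* : ∀ {N} (f g : Vector Bool N → ℕ) → Independent f g →
               sumAll N (λ σ → f σ * g σ) * 2 ^ N ≡ sumAll N f * sumAll N g
    sumAll-* {zero}  f g _ = *-identityʳ _
    sumAll-* {suc N} f g f⊥g with f⊥g zero
    ... | inj₁ f-ign = sumAll-*-headIgnored f g f⊥g f-ign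
    ... | inj₂ g-ign = begin
      sumAll (suc N) (λ σ → f σ * g σ) * 2 ^ suc N
        ≡⟨ cong (_* 2 ^ suc N) (sumAll-cong (λ σ → *-comm (f σ) (g σ))) ⟩
      sumAll (suc N) (λ σ → g σ * f σ) * 2 ^ suc N
        ≡⟨ sumAll-*-headIgnored g f (Independent-sym f⊥g) g-ign ⟩
      sumAll (suc N) g * sumAll (suc N) f
        ≡⟨ *-comm (sumAll (suc N) g) (sumAll (suc N) f) ⟩
      sumAll (suc N) f * sumAll (suc N) g ∎
      where open ≡-Reasoning

    sumAll-*-headIgnored : ∀ {N} (f g : Vector Bool (suc N) → ℕ) → Independent f g → Ignores f zero →
                           sumAll (suc N) (λ σ → f σ * g σ) * 2 ^ suc N ≡ sumAll (suc N) f * sumAll (suc N) g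
    sumAll-*-headIgnored {N} f g f⊥g f-ign = begin
      (sumAll N (λ σ → fᵗ σ * gᵗ σ) + sumAll N (λ σ → fᶠ σ * gᶠ σ)) * (2 * P)
        ≡⟨ cong (λ s → (sumAll N (λ σ → fᵗ σ * gᵗ σ) + s) * (2 * P))
                (sumAll-cong λ σ → cong (_* gᶠ σ) (sym (fᵗ≗fᶠ σ))) ⟩
      (sumAll N (λ σ → fᵗ σ * gᵗ σ) + sumAll N (λ σ → fᵗ σ * gᶠ σ)) * (2 * P)
        ≡⟨ distribute (sumAll N (λ σ → fᵗ σ * gᵗ σ)) (sumAll N (λ σ → fᵗ σ * gᶠ σ)) P ⟩
      2 * (sumAll N (λ σ → fᵗ σ * gᵗ σ) * P) + 2 * (sumAll N (λ σ → fᵗ σ * gᶠ σ) * P)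
        ≡⟨ cong₂ (λ a b → 2 * a + 2 * b) (sumAll-* fᵗ gᵗ (Independent-withHead true true f⊥g))
                                         (sumAll-* fᵗ gᶠ (Independent-withHead true false f⊥g)) ⟩
      2 * (F * sumAll N gᵗ) + 2 * (F * sumAll N gᶠ)
        ≡⟨ collect F (sumAll N gᵗ) (sumAll N gᶠ) ⟩
      (F + F) * (sumAll N gᵗ + sumAll N gᶠ)
        ≡⟨ cong (λ s → (F + s) * (sumAll N gᵗ + sumAll N gᶠ)) (sumAll-cong fᵗ≗fᶠ) ⟩
      (F + sumAll N fᶠ) * (sumAll N gᵗ + sumAll N gᶠ) ∎
      where
      open ≡-Reasoning
      P = 2 ^ N
      fᵗ fᶠ gᵗ gᶠ : Vector Bool N → ℕ
      fᵗ = withHead true f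
      fᶠ = withHead false f
      gᵗ = withHead true g
      gᶠ = withHead false g
      fᵗ≗fᶠ : ∀ σ → fᵗ σ ≡ fᶠ σ
      fᵗ≗fᶠ = Ignores-zero⇒withHead f-ign
      F = sumAll N fᵗ
      distribute : ∀ a b p → (a + b) * (2 * p) ≡ 2 * (a * p) + 2 * (b * p)
      distribute = solve-∀
      collect : ∀ x a b → 2 * (x * a) + 2 * (x * b) ≡ (x + x) * (a + b)
      collect = solve-∀

  sumAll-*-≤ : ∀ {N} {f g : Vector Bool N → ℕ} {x y a b} → Independent f g →
               sumAll N f * x ≤ a * 2 ^ N → sumAll N g * y ≤ b * 2 ^ N →
               sumAll N (λ σ → f σ * g σ) * (x * y) ≤ (a * b) * 2 ^ N
  sumAll-*-≤ {N} {f} {g} {x} {y} {a} {b} f⊥g Sf≤ Sg≤ = *-cancelʳ-≤ _ _ P (begin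
    S * (x * y) * P                      ≡⟨ *-CS.xy∙z≈xz∙y S (x * y) P ⟩
    S * P * (x * y)                      ≡⟨ cong (_* (x * y)) (sumAll-* f g f⊥g) ⟩
    sumAll N f * sumAll N g * (x * y)    ≡⟨ *-CS.interchange (sumAll N f) (sumAll N g) x y ⟩
    (sumAll N f * x) * (sumAll N g * y)  ≤⟨ *-mono-≤ Sf≤ Sg≤ ⟩
    (a * P) * (b * P)                    ≡⟨ *-CS.interchange a P b P ⟩
    (a * b) * (P * P)                    ≡⟨ *-assoc (a * b) P P ⟨
    (a * b) * P * P                      ∎)
    where
    open ≤-Reasoning
    S = sumAll N (λ σ → f σ * g σ)
    P = 2 ^ N
    instance _ = m^n≢0 2 N

  𝟙 : Bool → ℕ
  𝟙 true  = 1
  𝟙 false = 0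

  𝟙≤1 : ∀ a → 𝟙 a ≤ 1
  𝟙≤1 true  = ≤-refl
  𝟙≤1 false = z≤n

  𝟙-not-∧ : ∀ a b → 𝟙 (not (a ∧ b)) + 𝟙 a * 𝟙 b ≡ 1
  𝟙-not-∧ true  true  = refl
  𝟙-not-∧ true  false = refl
  𝟙-not-∧ false _     = refl

  𝟙+𝟙≤𝟙∧+1 : ∀ a b → 𝟙 a + 𝟙 b ≤ 𝟙 (a ∧ b) + 1
  𝟙+𝟙≤𝟙∧+1 true  b = ≤-reflexive (+-comm 1 (𝟙 b))
  𝟙+𝟙≤𝟙∧+1 false b = 𝟙≤1 b

  -- Coins for the undirected edges

  module _ {n : ℕ} where

    data OnPair (x y : Fin n) (i : Fin (n * n)) : Set where
      fwd : i ≡ combine x y → OnPair x y i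
      bwd : i ≡ combine y x → OnPair x y i

    onPair? : ∀ x y i → Dec (OnPair x y i)
    onPair? x y i with i Fin.≟ combine x y | i Fin.≟ combine y x
    ... | yes i≡xy | _        = yes (fwd i≡xy)
    ... | no _     | yes i≡yx = yes (bwd i≡yx)
    ... | no i≢xy  | no i≢yx  = no λ { (fwd i≡xy) → i≢xy i≡xy ; (bwd i≡yx) → i≢yx i≡yx }

    OnPair-sym : ∀ {x y i} → OnPair x y i → OnPair y x i
    OnPair-sym (fwd i≡xy) = bwd i≡xy
    OnPair-sym (bwd i≡yx) = fwd i≡yx

    OnPair-endpoints : ∀ {x y x′ y′ i} → OnPair x y i → OnPair x′ y′ i →
                       (x ≡ x′ × y ≡ y′) ⊎ (x ≡ y′ × y ≡ x′)
    OnPair-endpoints {x} {y} {x′} {y′} (fwd refl) (fwd e) = inj₁ (Fin.combine-injective x y x′ y′ e)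
    OnPair-endpoints {x} {y} {x′} {y′} (fwd refl) (bwd e) = inj₂ (Fin.combine-injective x y y′ x′ e)
    OnPair-endpoints {x} {y} {x′} {y′} (bwd refl) (fwd e) = inj₂ (Product.swap (Fin.combine-injective y x x′ y′ e))
    OnPair-endpoints {x} {y} {x′} {y′} (bwd refl) (bwd e) = inj₁ (Product.swap (Fin.combine-injective y x y′ x′ e))

    OnPair-shared : ∀ {a a′ w w′ i} → OnPair a w i → OnPair a′ w′ i → w ≢ a′ → w ≡ w′
    OnPair-shared p q w≢a′ with OnPair-endpoints p q
    ... | inj₁ (_ , w≡w′) = w≡w′
    ... | inj₂ (_ , w≡a′) = ⊥-elim (w≢a′ w≡a′)

    -- The edge {x, y} with x < y is decided by bit combine x y; coin σ x y is true when
    -- it is oriented from x to y.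
    coinBy : Vector Bool (n * n) → (x y : Fin n) → Tri (x Fin.< y) (x ≡ y) (y Fin.< x) → Bool
    coinBy σ x y (tri< _ _ _) = σ (combine x y)
    coinBy σ x y (tri≈ _ _ _) = false
    coinBy σ x y (tri> _ _ _) = not (σ (combine y x))

    coin : Vector Bool (n * n) → Fin n → Fin n → Bool
    coin σ x y = coinBy σ x y (Fin.<-cmp x y)

    coin-flip : ∀ σ {x y} → x ≢ y → coin σ y x ≡ not (coin σ x y)
    coin-flip σ {x} {y} x≢y = flipBy (Fin.<-cmp x y) (Fin.<-cmp y x)
      where
      flipBy : ∀ t t′ → coinBy σ y x t′ ≡ not (coinBy σ x y t)
      flipBy (tri< _ _ _)   (tri> _ _ _)   = refl
      flipBy (tri> _ _ _)   (tri< _ _ _)   = sym (not-involutive _)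
      flipBy (tri< _ _ y≮x) (tri< y<x _ _) = ⊥-elim (y≮x y<x)
      flipBy (tri> x≮y _ _) (tri> _ _ x<y) = ⊥-elim (x≮y x<y)
      flipBy (tri≈ _ x≡y _) _              = ⊥-elim (x≢y x≡y)
      flipBy _              (tri≈ _ y≡x _) = ⊥-elim (x≢y (sym y≡x))

    coin-ignores : ∀ {x y i} → ¬ OnPair x y i → Ignores (λ σ → coin σ x y) i
    coin-ignores {x} {y} {i} i∉xy σ τ σ≈τ with Fin.<-cmp x y
    ... | tri< _ _ _ = σ≈τ (combine x y) (i∉xy ∘ fwd ∘ sym)
    ... | tri≈ _ _ _ = refl
    ... | tri> _ _ _ = cong not (σ≈τ (combine y x) (i∉xy ∘ bwd ∘ sym))

    sumAll-coin : ∀ {x y} → x ≢ y → sumAll (n * n) (λ σ → 𝟙 (coin σ x y)) * 2 ≡ 2 ^ (n * n)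
    sumAll-coin {x} {y} x≢y with Fin.<-cmp x y
    ... | tri< _ _ _   = trans (sumAll-bit (combine x y) 𝟙) (*-identityˡ _)
    ... | tri≈ _ x≡y _ = ⊥-elim (x≢y x≡y)
    ... | tri> _ _ _   = trans (sumAll-bit (combine y x) (𝟙 ∘ not)) (*-identityˡ _)

  -- Random orientations of a mixed graph

  orient : EdgeKind → Bool → Bool
  orient none  _ = false
  orient undir b = b
  orient out   _ = true
  orient inn   _ = false

  allowsArc : EdgeKind → Bool
  allowsArc undir = true
  allowsArc out   = true
  allowsArc _     = false

  isNbr≤allowsArc+isIn : ∀ k → isNbr k ≤ 𝟙 (allowsArc k) + isIn k
  isNbr≤allowsArc+isIn none  = z≤n
  isNbr≤allowsArc+isIn undir = ≤-refl
  isNbr≤allowsArc+isIn out   = ≤-refl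
  isNbr≤allowsArc+isIn inn   = ≤-refl

  isNbr≤allowsArc-flip+isOut : ∀ k → isNbr k ≤ 𝟙 (allowsArc (flipKind k)) + isOut k
  isNbr≤allowsArc-flip+isOut none  = z≤n
  isNbr≤allowsArc-flip+isOut undir = ≤-refl
  isNbr≤allowsArc-flip+isOut out   = ≤-refl
  isNbr≤allowsArc-flip+isOut inn   = ≤-refl

  module _ {n : ℕ} (G : MixedGraph n) where

    undir-irrefl : ∀ {x y} → adj G x y ≡ undir → x ≢ y
    undir-irrefl {x} e refl with trans (sym (loopless G x)) e
    ... | ()

    orientBy : Vector Bool (n * n) → Digraph n
    orientBy σ x y = orient (adj G x y) (coin σ x y)

    orientBy-isOrientation : ∀ σ → IsOrientation G (orientBy σ)
    orientBy-isOrientation σ x y rewrite coherent G x y with adj G x y in e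
    ... | none  = refl
    ... | undir = subst (OrientOK undir (coin σ x y)) (sym (coin-flip σ (undir-irrefl e))) (not-¬ refl)
    ... | out   = refl
    ... | inn   = refl

    orientBy-loop : ∀ σ x → orientBy σ x x ≡ false
    orientBy-loop σ x = cong (λ k → orient k (coin σ x x)) (loopless G x)

    orientBy-ignores : ∀ {x y i} → ¬ OnPair x y i → Ignores (λ σ → orientBy σ x y) i
    orientBy-ignores {x} {y} i∉xy = Ignores-∘ (orient (adj G x y)) (coin-ignores {x = x} {y} i∉xy)

    sumAll-orientBy : ∀ {x y} → T (allowsArc (adj G x y)) →
                      2 ^ (n * n) ≤ sumAll (n * n) (λ σ → 𝟙 (orientBy σ x y)) * 2
    sumAll-orientBy {x} {y} allowed with adj G x y in e
    ... | undir = ≤-reflexive (sym (sumAll-coin (undir-irrefl e)))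
    ... | out   = begin
      2 ^ (n * n)                   ≤⟨ m≤m*n (2 ^ (n * n)) 2 ⟩
      2 ^ (n * n) * 2               ≡⟨ cong (_* 2) (trans (sumAll-const (n * n) 1) (*-identityˡ _)) ⟨
      sumAll (n * n) (λ _ → 1) * 2  ∎
      where open ≤-Reasoning

    blocked : Fin n → Fin n → Fin n → Vector Bool (n * n) → ℕ
    blocked u v w σ = 𝟙 (not (orientBy σ u w ∧ orientBy σ w v))

    routable : Fin n → Fin n → Fin n → Bool
    routable u v w = allowsArc (adj G u w) ∧ allowsArc (adj G w v)

    routes : Fin n → Fin n → List (Fin n) → ℕ
    routes u v ws = sum (map (λ w → 𝟙 (routable u v w)) ws)

    allBlocked : Fin n → Fin n → List (Fin n) → Vector Bool (n * n) → ℕ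
    allBlocked u v ws σ = product (map (λ w → blocked u v w σ) ws)

    blocked≡0 : ∀ {u v w σ} → blocked u v w σ ≡ 0 → orientBy σ u w ≡ true × orientBy σ w v ≡ true
    blocked≡0 {u} {v} {w} {σ} _ with orientBy σ u w | orientBy σ w v
    ... | true | true = refl , refl

    legs-independent : ∀ {u v} w → u ≢ v →
                       Independent (λ σ → 𝟙 (orientBy σ u w)) (λ σ → 𝟙 (orientBy σ w v))
    legs-independent {u} {v} w u≢v i with onPair? u w i
    ... | no  i∉uw = inj₁ (Ignores-∘ 𝟙 (orientBy-ignores i∉uw))
    ... | yes i∈uw =
      inj₂ (Ignores-∘ 𝟙 (orientBy-ignores λ i∈wv → u≢v (same-ends (OnPair-endpoints i∈uw i∈wv))))
      where
      same-ends : (u ≡ w × w ≡ v) ⊎ (u ≡ v × w ≡ w) → u ≡ v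
      same-ends (inj₁ (u≡w , w≡v)) = trans u≡w w≡v
      same-ends (inj₂ (u≡v , _))   = u≡v

    sumAll-route : ∀ {u v} w → u ≢ v → T (routable u v w) →
                   2 ^ (n * n) ≤ sumAll (n * n) (λ σ → 𝟙 (orientBy σ u w) * 𝟙 (orientBy σ w v)) * 4
    sumAll-route {u} {v} w u≢v route = *-cancelʳ-≤ P _ P (begin
      P * P                ≤⟨ *-mono-≤ (sumAll-orientBy uw) (sumAll-orientBy wv) ⟩
      (S₁ * 2) * (S₂ * 2)  ≡⟨ *-CS.interchange S₁ 2 S₂ 2 ⟩
      (S₁ * S₂) * 4        ≡⟨ cong (_* 4) (sumAll-* _ _ (legs-independent w u≢v)) ⟨
      (S₁₂ * P) * 4        ≡⟨ *-CS.xy∙z≈xz∙y S₁₂ P 4 ⟩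
      (S₁₂ * 4) * P        ∎)
      where
      open ≤-Reasoning
      P = 2 ^ (n * n)
      instance _ = m^n≢0 2 (n * n)
      S₁ = sumAll (n * n) (λ σ → 𝟙 (orientBy σ u w))
      S₂ = sumAll (n * n) (λ σ → 𝟙 (orientBy σ w v))
      S₁₂ = sumAll (n * n) (λ σ → 𝟙 (orientBy σ u w) * 𝟙 (orientBy σ w v))
      uw = proj₁ (Equivalence.to T-∧ route)
      wv = proj₂ (Equivalence.to T-∧ route)

    sumAll-blocked-routable : ∀ {u v} w → u ≢ v → T (routable u v w) →
                              sumAll (n * n) (blocked u v w) * 4 ≤ 3 * 2 ^ (n * n)
    sumAll-blocked-routable {u} {v} w u≢v route = +-cancelʳ-≤ P _ _ (begin
      Sb * 4 + P       ≤⟨ +-monoʳ-≤ (Sb * 4) (sumAll-route w u≢v route) ⟩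
      Sb * 4 + Sr * 4  ≡⟨ *-distribʳ-+ 4 Sb Sr ⟨
      (Sb + Sr) * 4    ≡⟨ cong (_* 4) (sumAll-+ (blocked u v w) _) ⟨
      sumAll (n * n) (λ σ → blocked u v w σ + 𝟙 (orientBy σ u w) * 𝟙 (orientBy σ w v)) * 4
                       ≡⟨ cong (_* 4) (sumAll-cong λ σ → 𝟙-not-∧ (orientBy σ u w) (orientBy σ w v)) ⟩
      sumAll (n * n) (λ _ → 1) * 4
                       ≡⟨ cong (_* 4) (trans (sumAll-const (n * n) 1) (*-identityˡ P)) ⟩
      P * 4            ≡⟨ trans (*-comm P 4) (+-comm P (3 * P)) ⟩
      3 * P + P        ∎)
      where
      open ≤-Reasoning
      P = 2 ^ (n * n)
      Sb = sumAll (n * n) (blocked u v w)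
      Sr = sumAll (n * n) (λ σ → 𝟙 (orientBy σ u w) * 𝟙 (orientBy σ w v))

    sumAll-blocked : ∀ {u v} w → u ≢ v →
                     sumAll (n * n) (blocked u v w) * 4 ^ 𝟙 (routable u v w) ≤ 3 ^ 𝟙 (routable u v w) * 2 ^ (n * n)
    sumAll-blocked {u} {v} w u≢v with routable u v w in route
    ... | true  = sumAll-blocked-routable w u≢v (subst T (sym route) tt)
    ... | false = begin
      sumAll (n * n) (blocked u v w) * 1  ≡⟨ *-identityʳ _ ⟩
      sumAll (n * n) (blocked u v w)      ≤⟨ sumAll-mono {n * n} (λ σ → 𝟙≤1 _) ⟩
      sumAll (n * n) (λ _ → 1)            ≡⟨ sumAll-const (n * n) 1 ⟩
      1 * 2 ^ (n * n)                     ∎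
      where open ≤-Reasoning

    blocked-endpoint : ∀ {u v w} → w ≡ u ⊎ w ≡ v → ∀ σ → blocked u v w σ ≡ 1
    blocked-endpoint {u} {v} (inj₁ refl) σ rewrite orientBy-loop σ u = refl
    blocked-endpoint {u} {v} (inj₂ refl) σ rewrite orientBy-loop σ v | ∧-zeroʳ (orientBy σ u v) = refl

    Touches : Fin n → Fin n → Fin n → Fin (n * n) → Set
    Touches u v w i = OnPair u w i ⊎ OnPair w v i

    blocked-ignores : ∀ {u v w i} → ¬ Touches u v w i → Ignores (blocked u v w) i
    blocked-ignores i∉ σ τ σ≈τ =
      cong₂ (λ a b → 𝟙 (not (a ∧ b))) (orientBy-ignores (i∉ ∘ inj₁) σ τ σ≈τ)
                                      (orientBy-ignores (i∉ ∘ inj₂) σ τ σ≈τ)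

    Touches-unique : ∀ {u v w w′ i} → ¬ (w ≡ u ⊎ w ≡ v) → Touches u v w i → Touches u v w′ i → w ≡ w′
    Touches-unique w∉uv (inj₁ p) (inj₁ q) = OnPair-shared p q (w∉uv ∘ inj₁)
    Touches-unique w∉uv (inj₁ p) (inj₂ q) = OnPair-shared p (OnPair-sym q) (w∉uv ∘ inj₂)
    Touches-unique w∉uv (inj₂ p) (inj₁ q) = OnPair-shared (OnPair-sym p) q (w∉uv ∘ inj₁)
    Touches-unique w∉uv (inj₂ p) (inj₂ q) = OnPair-shared (OnPair-sym p) (OnPair-sym q) (w∉uv ∘ inj₂)

    blocked-independent : ∀ {u v w} ws → All (w ≢_) ws → Independent (blocked u v w) (allBlocked u v ws)
    blocked-independent {u} {v} {w} ws w∉ws i with (w Fin.≟ u) ⊎-dec (w Fin.≟ v)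
    ... | yes w∈uv = inj₁ (Ignores-const (blocked-endpoint w∈uv))
    ... | no  w∉uv with onPair? u w i ⊎-dec onPair? w v i
    ...   | no  ¬touch = inj₁ (blocked-ignores ¬touch)
    ...   | yes touch  = inj₂ (Ignores-product (blocked u v) ws
                                (All.map (λ w≢w′ → blocked-ignores (w≢w′ ∘ Touches-unique w∉uv touch)) w∉ws))

    sumAll-allBlocked : ∀ {u v} → u ≢ v → ∀ ws → Unique ws →
                        sumAll (n * n) (allBlocked u v ws) * 4 ^ routes u v ws ≤ 3 ^ routes u v ws * 2 ^ (n * n)
    sumAll-allBlocked u≢v [] [] = ≤-reflexive (trans (*-identityʳ _) (sumAll-const (n * n) 1))
    sumAll-allBlocked {u} {v} u≢v (w ∷ ws) (w∉ws ∷ ws-unique) = begin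
      S * 4 ^ (r + R)                ≡⟨ cong (S *_) (^-distribˡ-+-* 4 r R) ⟩
      S * (4 ^ r * 4 ^ R)            ≤⟨ sumAll-*-≤ {x = 4 ^ r} {4 ^ R} {3 ^ r} {3 ^ R} (blocked-independent ws w∉ws)
                                                   (sumAll-blocked w u≢v) (sumAll-allBlocked u≢v ws ws-unique) ⟩
      (3 ^ r * 3 ^ R) * 2 ^ (n * n)  ≡⟨ cong (_* 2 ^ (n * n)) (^-distribˡ-+-* 3 r R) ⟨
      3 ^ (r + R) * 2 ^ (n * n)      ∎
      where
      open ≤-Reasoning
      S = sumAll (n * n) (allBlocked u v (w ∷ ws))
      r = 𝟙 (routable u v w)
      R = routes u v ws

    sumAll-allBlocked-< : ∀ {u v} → u ≢ v → ∀ {M} ws → Unique ws → 3 ^ routes u v ws * M < 4 ^ routes u v ws →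
                          sumAll (n * n) (allBlocked u v ws) * M < 2 ^ (n * n)
    sumAll-allBlocked-< {u} {v} u≢v {M} ws ws-unique 3ᴿM<4ᴿ = *-cancelʳ-< (4 ^ R) (S * M) P (begin-strict
      S * M * 4 ^ R  ≡⟨ *-CS.xy∙z≈xz∙y S M (4 ^ R) ⟩
      S * 4 ^ R * M  ≤⟨ *-monoˡ-≤ M (sumAll-allBlocked u≢v ws ws-unique) ⟩
      3 ^ R * P * M  ≡⟨ *-CS.xy∙z≈xz∙y (3 ^ R) P M ⟩
      3 ^ R * M * P  <⟨ *-monoˡ-< P 3ᴿM<4ᴿ ⟩
      4 ^ R * P      ≡⟨ *-comm (4 ^ R) P ⟩
      P * 4 ^ R      ∎)
      where
      open ≤-Reasoning
      S = sumAll (n * n) (allBlocked u v ws)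
      R = routes u v ws
      P = 2 ^ (n * n)
      instance _ = m^n≢0 2 (n * n)

    deg+deg≤routes : ∀ u v → deg G u + deg G v ≤ routes u v (allFin n) + n + degIn G u + degOut G v
    deg+deg≤routes u v = begin
      deg G u + deg G v                     ≤⟨ +-mono-≤ out-of-u into-v ⟩
      (Aᵤ + degIn G u) + (Aᵥ + degOut G v)  ≡⟨ +-interchange Aᵤ (degIn G u) Aᵥ (degOut G v) ⟩
      (Aᵤ + Aᵥ) + (degIn G u + degOut G v)  ≤⟨ +-monoˡ-≤ _ common ⟩
      (R + n) + (degIn G u + degOut G v)    ≡⟨ +-assoc (R + n) (degIn G u) (degOut G v) ⟨
      R + n + degIn G u + degOut G v        ∎
      where
      open ≤-Reasoning
      V = allFin n
      R = routes u v V
      Aᵤ = sum (map (λ w → 𝟙 (allowsArc (adj G u w))) V)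
      Aᵥ = sum (map (λ w → 𝟙 (allowsArc (adj G w v))) V)
      out-of-u : deg G u ≤ Aᵤ + degIn G u
      out-of-u = ≤-trans (sum-map-mono V (λ w → isNbr≤allowsArc+isIn (adj G u w))) (≤-reflexive (sum-map-+ _ _ V))
      into-v : deg G v ≤ Aᵥ + degOut G v
      into-v = ≤-trans (sum-map-mono V λ w →
                          subst (λ k → isNbr (adj G v w) ≤ 𝟙 (allowsArc k) + isOut (adj G v w))
                                (sym (coherent G v w)) (isNbr≤allowsArc-flip+isOut (adj G v w)))
                       (≤-reflexive (sum-map-+ _ _ V))
      common : Aᵤ + Aᵥ ≤ R + n
      common = begin
        Aᵤ + Aᵥ
          ≡⟨ sum-map-+ _ _ V ⟨
        sum (map (λ w → 𝟙 (allowsArc (adj G u w)) + 𝟙 (allowsArc (adj G w v))) V)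
          ≤⟨ sum-map-mono V (λ w → 𝟙+𝟙≤𝟙∧+1 (allowsArc (adj G u w)) (allowsArc (adj G w v))) ⟩
        sum (map (λ w → 𝟙 (routable u v w) + 1) V)
          ≡⟨ sum-map-+ _ _ V ⟩
        R + sum (map (λ _ → 1) V)
          ≡⟨ cong (R +_) (trans (sum-map-1 V) (length-allFin n)) ⟩
        R + n  ∎

  -- An orientation of diameter two

  DiamLE⇒StronglyConnected : ∀ {n} {D : Digraph n} {k} → DiamLE D k → StronglyConnected D
  DiamLE⇒StronglyConnected {k = k} diam≤k u v with u Fin.≟ v
  ... | yes refl = 0 , 0 , z≤n , here
  ... | no  u≢v  = k , diam≤k u v u≢v

  DistLE-1⇒arc : ∀ {n} {D : Digraph n} {x y} → x ≢ y → DistLE D 1 x y → D x y ≡ true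
  DistLE-1⇒arc x≢y (_ , _      , here)              = ⊥-elim (x≢y refl)
  DistLE-1⇒arc x≢y (_ , _      , step xy here)      = xy
  DistLE-1⇒arc x≢y (_ , s≤s () , step _ (step _ _))

  ¬OrientOK-both-ways : ∀ k → OrientOK k true true → OrientOK (flipKind k) true true → ⊥
  ¬OrientOK-both-ways none  () _
  ¬OrientOK-both-ways undir t≢t _ = t≢t refl
  ¬OrientOK-both-ways out   _ ()
  ¬OrientOK-both-ways inn   () _

  ¬DiamLE-1 : ∀ {m} (G : MixedGraph (suc (suc m))) D → IsOrientation G D → ¬ DiamLE D 1
  ¬DiamLE-1 G D D-orients diam≤1 =
    ¬OrientOK-both-ways (adj G x y) (subst₂ (OrientOK (adj G x y)) xy yx (D-orients x y))
                                    (subst (λ k → OrientOK k true true) (coherent G x y)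
                                           (subst₂ (OrientOK (adj G y x)) yx xy (D-orients y x)))
    where
    x y : Fin _
    x = zero
    y = suc zero
    xy = DistLE-1⇒arc (λ ()) (diam≤1 x y (λ ()))
    yx = DistLE-1⇒arc (λ ()) (diam≤1 y x (λ ()))

  module _ {n : ℕ} (G : MixedGraph n) where

    -- Diagonal pairs are excluded: allBlocked G u u is constantly 1.
    missing : (u v : Fin n) → Dec (u ≡ v) → Vector Bool (n * n) → ℕ
    missing u v (yes _) _ = 0
    missing u v (no _)  σ = allBlocked G u v (allFin n) σ

    rowFailures : Fin n → Vector Bool (n * n) → ℕ
    rowFailures u σ = sum (map (λ v → missing u v (u Fin.≟ v) σ) (allFin n))

    failures : Vector Bool (n * n) → ℕ
    failures σ = sum (map (λ u → rowFailures u σ) (allFin n))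

    failures≡0⇒DiamLE-2 : ∀ σ → failures σ ≡ 0 → DiamLE (orientBy G σ) 2
    failures≡0⇒DiamLE-2 σ no-failure u v u≢v =
      route (u Fin.≟ v) (sum-map-≡0 (allFin n) (sum-map-≡0 (allFin n) no-failure (∈-allFin u)) (∈-allFin v))
      where
      route : (d : Dec (u ≡ v)) → missing u v d σ ≡ 0 → DistLE (orientBy G σ) 2 u v
      route (yes u≡v) _        = ⊥-elim (u≢v u≡v)
      route (no _)    no-route with product-map-≡0 (allFin n) no-route
      ... | w , w-blocked with blocked≡0 G {u} {v} {w} {σ} w-blocked
      ...   | uw , wv = 2 , ≤-refl , step uw (step wv here)

    module _ (unlikely : ∀ u v → u ≢ v →
                         3 ^ routes G u v (allFin n) * (n * n) < 4 ^ routes G u v (allFin n)) where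

      sumAll-missing : ∀ u v d → sumAll (n * n) (missing u v d) * (n * n) ≤ pred (2 ^ (n * n))
      sumAll-missing u v (yes _)  =
        subst (λ s → s * (n * n) ≤ pred (2 ^ (n * n))) (sym (sumAll-const (n * n) 0)) z≤n
      sumAll-missing u v (no u≢v) = <⇒≤pred (sumAll-allBlocked-< G u≢v (allFin n) (allFin⁺ n) (unlikely u v u≢v))

      sumAll-rowFailures : ∀ u → sumAll (n * n) (rowFailures u) * (n * n) ≤ n * pred (2 ^ (n * n))
      sumAll-rowFailures u = begin
        sumAll (n * n) (rowFailures u) * (n * n)
          ≡⟨ cong (_* (n * n)) (sumAll-sum (n * n) (λ v → missing u v (u Fin.≟ v)) (allFin n)) ⟩
        sum (map (λ v → sumAll (n * n) (missing u v (u Fin.≟ v))) (allFin n)) * (n * n)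
          ≤⟨ sum-map-*-≤ (allFin n) (λ v → sumAll-missing u v (u Fin.≟ v)) ⟩
        length (allFin n) * pred (2 ^ (n * n))
          ≡⟨ cong (_* pred (2 ^ (n * n))) (length-allFin n) ⟩
        n * pred (2 ^ (n * n))  ∎
        where open ≤-Reasoning

      sumAll-failures : .{{NonZero n}} → sumAll (n * n) failures < 2 ^ (n * n)
      sumAll-failures = *-cancelʳ-< (n * n) _ _ (begin-strict
        sumAll (n * n) failures * (n * n)
          ≡⟨ cong (_* (n * n)) (sumAll-sum (n * n) rowFailures (allFin n)) ⟩
        sum (map (λ u → sumAll (n * n) (rowFailures u)) (allFin n)) * (n * n)
          ≤⟨ sum-map-*-≤ (allFin n) sumAll-rowFailures ⟩
        length (allFin n) * (n * pred (2 ^ (n * n)))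
          ≡⟨ cong (_* (n * pred (2 ^ (n * n)))) (length-allFin n) ⟩
        n * (n * pred (2 ^ (n * n)))
          ≡⟨ trans (sym (*-assoc n n _)) (*-comm (n * n) (pred (2 ^ (n * n)))) ⟩
        pred (2 ^ (n * n)) * (n * n)
          <⟨ *-monoˡ-< (n * n) {{m*n≢0 n n}} (pred[n]<n {{m^n≢0 2 (n * n)}}) ⟩
        2 ^ (n * n) * (n * n)  ∎)
        where open ≤-Reasoning

  oriented-diameter-2 : ∀ {m} (G : MixedGraph (suc (suc m))) →
    (∀ u v → u ≢ v → 3 ^ routes G u v (allFin _) * (suc (suc m) * suc (suc m)) < 4 ^ routes G u v (allFin _)) →
    OrientedDiamIs G 2
  oriented-diameter-2 G unlikely =
    (orientBy G σ , orientBy-isOrientation G σ , DiamLE⇒StronglyConnected diam≤2 , diam≤2) ,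
    (λ D D-orients _ → ¬DiamLE-1 G D D-orients)
    where
    σ₀ = sumAll<⇒∃≡0 _ (failures G) (sumAll-failures G unlikely)
    σ = proj₁ σ₀
    diam≤2 = failures≡0⇒DiamLE-2 G σ (proj₂ σ₀)

  ^-distribʳ-* : ∀ a b n → (a * b) ^ n ≡ a ^ n * b ^ n
  ^-distribʳ-* a b zero    = refl
  ^-distribʳ-* a b (suc n) = trans (cong (a * b *_) (^-distribʳ-* a b n)) (*-CS.interchange a b (a ^ n) (b ^ n))

  ^-split : ∀ b k q p r → p + p + r ≡ k * q → (b ^ k) ^ q ≡ b ^ r * (b ^ p * b ^ p)
  ^-split b k q p r p+p+r≡kq = begin
    (b ^ k) ^ q           ≡⟨ ^-*-assoc b k q ⟩
    b ^ (k * q)           ≡⟨ cong (b ^_) p+p+r≡kq ⟨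
    b ^ (p + p + r)       ≡⟨ ^-distribˡ-+-* b (p + p) r ⟩
    b ^ (p + p) * b ^ r   ≡⟨ cong (_* b ^ r) (^-distribˡ-+-* b p p) ⟩
    b ^ p * b ^ p * b ^ r ≡⟨ *-comm (b ^ p * b ^ p) (b ^ r) ⟩
    b ^ r * (b ^ p * b ^ p) ∎
    where open ≡-Reasoning

  -- Raise to the q-th power: (3^k m²)^q = 3^(kq - 2p) (3^p m^q)² ≤ 4^(kq - 2p) (4^p)² = (4^k)^q.
  3^k*m²≤4^k : ∀ {p q k m} .{{_ : NonZero q}} → 3 ^ p * m ^ q ≤ 4 ^ p → p + p ≤ k * q →
               3 ^ k * (m * m) ≤ 4 ^ k
  3^k*m²≤4^k {p} {q} {k} {m} 3ᵖmᵠ≤4ᵖ 2p≤kq =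
    ≮⇒≥ λ 4ᵏ<3ᵏm² → <⇒≱ (^-monoˡ-< q 4ᵏ<3ᵏm²) powered
    where
    r = k * q ∸ (p + p)
    p+p+r≡kq : p + p + r ≡ k * q
    p+p+r≡kq = m+[n∸m]≡n 2p≤kq
    regroup : ∀ t a b → t * (a * a) * (b * b) ≡ t * ((a * b) * (a * b))
    regroup = solve-∀
    powered : (3 ^ k * (m * m)) ^ q ≤ (4 ^ k) ^ q
    powered = begin
      (3 ^ k * (m * m)) ^ q                       ≡⟨ ^-distribʳ-* (3 ^ k) (m * m) q ⟩
      (3 ^ k) ^ q * (m * m) ^ q                   ≡⟨ cong₂ _*_ (^-split 3 k q p r p+p+r≡kq) (^-distribʳ-* m m q) ⟩
      3 ^ r * (3 ^ p * 3 ^ p) * (m ^ q * m ^ q)   ≡⟨ regroup (3 ^ r) (3 ^ p) (m ^ q) ⟩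
      3 ^ r * ((3 ^ p * m ^ q) * (3 ^ p * m ^ q)) ≤⟨ *-mono-≤ (^-monoˡ-≤ r (n≤1+n 3))
                                                                (*-mono-≤ 3ᵖmᵠ≤4ᵖ 3ᵖmᵠ≤4ᵖ) ⟩
      4 ^ r * (4 ^ p * 4 ^ p)                     ≡⟨ ^-split 4 k q p r p+p+r≡kq ⟨
      (4 ^ k) ^ q                                 ∎
      where open ≤-Reasoning

  4^k%3≡1 : ∀ k → 4 ^ k % 3 ≡ 1
  4^k%3≡1 zero    = refl
  4^k%3≡1 (suc k) = begin
    (4 ^ k + 3 * 4 ^ k) % 3  ≡⟨ cong (λ t → (4 ^ k + t) % 3) (*-comm 3 (4 ^ k)) ⟩
    (4 ^ k + 4 ^ k * 3) % 3  ≡⟨ [m+kn]%n≡m%n (4 ^ k) (4 ^ k) 3 ⟩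
    4 ^ k % 3                ≡⟨ 4^k%3≡1 k ⟩
    1                        ∎
    where open ≡-Reasoning

  3^k*[2+m]²≢4^k : ∀ k m → 3 ^ k * (suc (suc m) * suc (suc m)) ≢ 4 ^ k
  3^k*[2+m]²≢4^k zero    m ()
  3^k*[2+m]²≢4^k (suc k) m 3ᵏ⁺¹M≡4ᵏ⁺¹ = 0≢1+n (begin
    0                        ≡⟨ m*n%n≡0 (3 ^ k * M) 3 ⟨
    3 ^ k * M * 3 % 3        ≡⟨ cong (_% 3) (*-CS.xy∙z≈z∙xy (3 ^ k) M 3) ⟩
    3 * (3 ^ k * M) % 3      ≡⟨ cong (_% 3) (*-assoc 3 (3 ^ k) M) ⟨
    3 ^ suc k * M % 3        ≡⟨ cong (_% 3) 3ᵏ⁺¹M≡4ᵏ⁺¹ ⟩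
    4 ^ suc k % 3            ≡⟨ 4^k%3≡1 (suc k) ⟩
    1                        ∎)
    where
    open ≡-Reasoning
    M = suc (suc m) * suc (suc m)

module _ where

  import Data.Integer as ℤ
  import Data.Integer.Properties as ℤ
  open import Data.Nat as ℕ using (ℕ; suc; _^_)
  import Data.Nat.Coprimality as Coprimality
  import Data.Nat.Properties as ℕ
  open import Data.Product using (_,_)
  open import Data.Rational as ℚ using (ℚ; mkℚ; ↥_; ↧ₙ_; 1ℚ; ½; toℚᵘ; _+_; _-_; _*_; -_; _≤_)
  import Data.Rational.Properties as ℚ
  open import Data.Rational.Solver using () renaming (module +-*-Solver to ℚ-Solver)
  import Data.Rational.Unnormalised as ℚᵘ
  import Data.Rational.Unnormalised.Properties as ℚᵘ
  open import Relation.Binary.PropositionalEquality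

  toℚᵘ-toℚ : ∀ k → toℚᵘ (toℚ k) ≡ ℚᵘ.mkℚᵘ (ℤ.+ k) 0
  toℚᵘ-toℚ k = cong toℚᵘ (ℚ.normalize-coprime (Coprimality.sym (Coprimality.1-coprimeTo k)))

  toℚ-mono-≤ : ∀ {a b} → a ℕ.≤ b → toℚ a ≤ toℚ b
  toℚ-mono-≤ {a} {b} a≤b =
    ℚ.toℚᵘ-cancel-≤ (subst₂ ℚᵘ._≤_ (sym (toℚᵘ-toℚ a)) (sym (toℚᵘ-toℚ b))
      (ℚᵘ.*≤* (subst₂ ℤ._≤_ (sym (ℤ.*-identityʳ (ℤ.+ a))) (sym (ℤ.*-identityʳ (ℤ.+ b))) (ℤ.+≤+ a≤b))))

  toℚ-+ : ∀ a b → toℚ (a ℕ.+ b) ≡ toℚ a + toℚ b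
  toℚ-+ a b = ℚ.toℚᵘ-injective (begin
    toℚᵘ (toℚ (a ℕ.+ b))                          ≡⟨ toℚᵘ-toℚ (a ℕ.+ b) ⟩
    ℚᵘ.mkℚᵘ (ℤ.+ (a ℕ.+ b)) 0                     ≈⟨ ℚᵘ.*≡* (cong (ℤ._* ℤ.+ 1) (sum-scaled a b)) ⟩
    ℚᵘ.mkℚᵘ (ℤ.+ a) 0 ℚᵘ.+ ℚᵘ.mkℚᵘ (ℤ.+ b) 0      ≡⟨ cong₂ ℚᵘ._+_ (toℚᵘ-toℚ a) (toℚᵘ-toℚ b) ⟨
    toℚᵘ (toℚ a) ℚᵘ.+ toℚᵘ (toℚ b)                ≈⟨ ℚ.toℚᵘ-homo-+ (toℚ a) (toℚ b) ⟨
    toℚᵘ (toℚ a + toℚ b)                          ∎)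
    where
    open ℚᵘ.≃-Reasoning
    sum-scaled : ∀ a b → ℤ.+ (a ℕ.+ b) ≡ ℤ.+ a ℤ.* ℤ.+ 1 ℤ.+ ℤ.+ b ℤ.* ℤ.+ 1
    sum-scaled a b =
      trans (ℤ.pos-+ a b) (cong₂ ℤ._+_ (sym (ℤ.*-identityʳ (ℤ.+ a))) (sym (ℤ.*-identityʳ (ℤ.+ b))))

  1-nonNeg : ∀ {c} → c ≤ 1ℚ → ℚ.NonNegative (1ℚ - c)
  1-nonNeg {c} c≤1 = ℚ.nonNegative (subst (_≤ 1ℚ - c) (ℚ.+-inverseʳ c) (ℚ.+-monoˡ-≤ (- c) c≤1))

  mixed-degree-bound : ∀ {c₁ c₂ δ du dv dI dO} → c₁ ≤ 1ℚ → c₂ ≤ 1ℚ → δ ≤ du → δ ≤ dv →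
                       dI ≤ c₂ * du → dO ≤ c₁ * dv → ((1ℚ + 1ℚ) - c₁ - c₂) * δ ≤ (du - dI) + (dv - dO)
  mixed-degree-bound {c₁} {c₂} {δ} {du} {dv} {dI} {dO} c₁≤1 c₂≤1 δ≤du δ≤dv dI≤ dO≤ = begin
    ((1ℚ + 1ℚ) - c₁ - c₂) * δ
      ≡⟨ split c₁ c₂ δ ⟩
    (1ℚ - c₂) * δ + (1ℚ - c₁) * δ
      ≤⟨ ℚ.+-mono-≤ (ℚ.*-monoˡ-≤-nonNeg (1ℚ - c₂) {{1-nonNeg c₂≤1}} δ≤du)
                    (ℚ.*-monoˡ-≤-nonNeg (1ℚ - c₁) {{1-nonNeg c₁≤1}} δ≤dv) ⟩
    (1ℚ - c₂) * du + (1ℚ - c₁) * dv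
      ≡⟨ expand c₁ c₂ du dv ⟩
    (du - c₂ * du) + (dv - c₁ * dv)
      ≤⟨ ℚ.+-mono-≤ (ℚ.+-monoʳ-≤ du (ℚ.neg-antimono-≤ dI≤)) (ℚ.+-monoʳ-≤ dv (ℚ.neg-antimono-≤ dO≤)) ⟩
    (du - dI) + (dv - dO) ∎
    where
    open ℚ.≤-Reasoning
    open ℚ-Solver
    split : ∀ c₁ c₂ δ → ((1ℚ + 1ℚ) - c₁ - c₂) * δ ≡ (1ℚ - c₂) * δ + (1ℚ - c₁) * δ
    split = solve 3 (λ c₁ c₂ δ → ((con 1ℚ :+ con 1ℚ) :- c₁ :- c₂) :* δ
                                 := (con 1ℚ :- c₂) :* δ :+ (con 1ℚ :- c₁) :* δ) refl
    expand : ∀ c₁ c₂ du dv → (1ℚ - c₂) * du + (1ℚ - c₁) * dv ≡ (du - c₂ * du) + (dv - c₁ * dv)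
    expand = solve 4 (λ c₁ c₂ du dv → (con 1ℚ :- c₂) :* du :+ (con 1ℚ :- c₁) :* dv
                                      := (du :- c₂ :* du) :+ (dv :- c₁ :* dv)) refl

  half+half : ∀ y → y * ½ + y * ½ ≡ y
  half+half y = trans (sym (ℚ.*-distribˡ-+ y ½ ½)) (ℚ.*-identityʳ y)

  excess-bound : ∀ {c₁ c₂} {δ du dv dI dO m k : ℕ} → c₁ ≤ 1ℚ → c₂ ≤ 1ℚ → δ ℕ.≤ du → δ ℕ.≤ dv →
                 toℚ dI ≤ c₂ * toℚ du → toℚ dO ≤ c₁ * toℚ dv → du ℕ.+ dv ℕ.≤ k ℕ.+ m ℕ.+ dI ℕ.+ dO →
                 let x = (((1ℚ + 1ℚ) - c₁ - c₂) * toℚ δ - toℚ m) * ½ in x + x ≤ toℚ k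
  excess-bound {c₁} {c₂} {δ} {du} {dv} {dI} {dO} {m} {k} c₁≤1 c₂≤1 δ≤du δ≤dv dI≤ dO≤ counted = begin
    y * ½ + y * ½
      ≡⟨ half+half y ⟩
    a * toℚ δ - M
      ≤⟨ ℚ.+-monoˡ-≤ (- M) (mixed-degree-bound c₁≤1 c₂≤1 (toℚ-mono-≤ δ≤du) (toℚ-mono-≤ δ≤dv) dI≤ dO≤) ⟩
    ((Du - I) + (Dv - O)) - M
      ≡⟨ regroup Du Dv I O M ⟩
    (Du + Dv) - (M + I + O)
      ≤⟨ ℚ.+-monoˡ-≤ (- (M + I + O)) counted-in-ℚ ⟩
    (K + M + I + O) - (M + I + O)
      ≡⟨ cancel K M I O ⟩
    K ∎
    where
    open ℚ.≤-Reasoning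
    open ℚ-Solver
    a = (1ℚ + 1ℚ) - c₁ - c₂
    y = a * toℚ δ - toℚ m
    Du = toℚ du
    Dv = toℚ dv
    I = toℚ dI
    O = toℚ dO
    M = toℚ m
    K = toℚ k
    counted-in-ℚ : Du + Dv ≤ K + M + I + O
    counted-in-ℚ = subst₂ _≤_ (toℚ-+ du dv)
      (trans (toℚ-+ (k ℕ.+ m ℕ.+ dI) dO) (cong (_+ O) (trans (toℚ-+ (k ℕ.+ m) dI) (cong (_+ I) (toℚ-+ k m)))))
      (toℚ-mono-≤ counted)
    regroup : ∀ Du Dv I O M → ((Du - I) + (Dv - O)) - M ≡ (Du + Dv) - (M + I + O)
    regroup = solve 5 (λ Du Dv I O M → ((Du :- I) :+ (Dv :- O)) :- M := (Du :+ Dv) :- (M :+ I :+ O)) refl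
    cancel : ∀ K M I O → (K + M + I + O) - (M + I + O) ≡ K
    cancel = solve 4 (λ K M I O → (K :+ M :+ I :+ O) :- (M :+ I :+ O) := K) refl

  numerator-bound : ∀ x {p k} → ↥ x ≡ ℤ.+ p → x + x ≤ toℚ k → p ℕ.+ p ℕ.≤ k ℕ.* ↧ₙ x
  numerator-bound x@(mkℚ _ d _) {p} {k} refl x+x≤k =
    ℕ.*-cancelʳ-≤ (p ℕ.+ p) (k ℕ.* q) q
                  (subst₂ ℕ._≤_ lhs rhs (ℤ.drop‿+≤+ (subst₂ ℤ._≤_ lhsℤ rhsℤ cross)))
    where
    q = suc d
    cross : (ℤ.+ p ℤ.* ℤ.+ q ℤ.+ ℤ.+ p ℤ.* ℤ.+ q) ℤ.* ℤ.+ 1 ℤ.≤ ℤ.+ k ℤ.* (ℤ.+ q ℤ.* ℤ.+ q)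
    cross = ℚᵘ.drop-*≤* (subst (toℚᵘ x ℚᵘ.+ toℚᵘ x ℚᵘ.≤_) (toℚᵘ-toℚ k)
                          (ℚᵘ.≤-respˡ-≃ (ℚ.toℚᵘ-homo-+ x x) (ℚ.toℚᵘ-mono-≤ x+x≤k)))
    lhsℤ : (ℤ.+ p ℤ.* ℤ.+ q ℤ.+ ℤ.+ p ℤ.* ℤ.+ q) ℤ.* ℤ.+ 1 ≡ ℤ.+ ((p ℕ.* q ℕ.+ p ℕ.* q) ℕ.* 1)
    lhsℤ = sym (trans (ℤ.pos-* (p ℕ.* q ℕ.+ p ℕ.* q) 1)
                      (cong (ℤ._* ℤ.+ 1) (trans (ℤ.pos-+ (p ℕ.* q) (p ℕ.* q))
                                                (cong₂ ℤ._+_ (ℤ.pos-* p q) (ℤ.pos-* p q)))))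
    rhsℤ : ℤ.+ k ℤ.* (ℤ.+ q ℤ.* ℤ.+ q) ≡ ℤ.+ (k ℕ.* (q ℕ.* q))
    rhsℤ = sym (ℤ.pos-* k (q ℕ.* q))
    lhs : (p ℕ.* q ℕ.+ p ℕ.* q) ℕ.* 1 ≡ (p ℕ.+ p) ℕ.* q
    lhs = trans (ℕ.*-identityʳ _) (sym (ℕ.*-distribʳ-+ q p p))
    rhs : k ℕ.* (q ℕ.* q) ≡ k ℕ.* q ℕ.* q
    rhs = sym (ℕ.*-assoc k q q)

  log-bound : ∀ {m} x k → Log43≤ (suc (suc m)) x → x + x ≤ toℚ k →
              3 ^ k ℕ.* (suc (suc m) ℕ.* suc (suc m)) ℕ.< 4 ^ k
  log-bound {m} x@(mkℚ _ _ _) k (p , ↥x≡p , 3ᵖnᵠ≤4ᵖ) x+x≤k =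
    ℕ.≤∧≢⇒< (3^k*m²≤4^k {p} {↧ₙ x} {k} 3ᵖnᵠ≤4ᵖ (numerator-bound x {p} {k} ↥x≡p x+x≤k))
            (3^k*[2+m]²≢4^k k m)


open import Data.Nat using (ℕ; suc)
open import Data.Rational using (ℚ; 0ℚ; 1ℚ; ½; _≤_; _<_; _+_; _-_; _*_)
import Data.Nat as ℕ
open import Data.Fin using (zero)
open import Data.Integer using (-[1+_])
open import Data.List using (allFin)
open import Data.Product using (_,_; proj₁; proj₂)
open import Data.Rational using (↥_)
import Data.Rational.Properties as ℚ
open import Relation.Binary.PropositionalEquality

-- The paper's ((2 - c₁ - c₂) δ - n) / 2: the hypothesis reads ln n / ln (4/3) ≤ excess.
excess : ∀ {m} → ℚ → ℚ → MixedGraph (suc m) → ℚ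
excess {m} c₁ c₂ G = (((1ℚ + 1ℚ) - c₁ - c₂) * toℚ (minDeg G) - toℚ (suc m)) * ½

minDeg-single : (G : MixedGraph 1) → minDeg G ≡ 0
minDeg-single G = cong (λ k → isNbr k ℕ.+ 0) (loopless G zero)

-- Hence the hypothesis fails for a single vertex: Log43≤ needs a nonnegative numerator.
↥-excess-single : ∀ c₁ c₂ (G : MixedGraph 1) → ↥ excess c₁ c₂ G ≡ -[1+ 0 ]
↥-excess-single c₁ c₂ G rewrite minDeg-single G | ℚ.*-zeroʳ ((1ℚ + 1ℚ) - c₁ - c₂) = refl

excess≤routes : ∀ {c₁ c₂ m} (G : MixedGraph (suc m)) → c₁ ≤ 1ℚ → c₂ ≤ 1ℚ → IsMixed c₁ c₂ G →
                ∀ u v →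
                excess c₁ c₂ G + excess c₁ c₂ G ≤ toℚ (routes G u v (allFin (suc m)))
excess≤routes {m = m} G c₁≤1 c₂≤1 mixed u v =
  excess-bound {δ = minDeg G} {deg G u} {deg G v} {degIn G u} {degOut G v} {suc m} {routes G u v (allFin (suc m))}
               c₁≤1 c₂≤1 (minFin-≤ (deg G) u) (minFin-≤ (deg G) v) (proj₂ (mixed u)) (proj₁ (mixed v))
               (deg+deg≤routes G u v)

theorem2p1 : (c₁ c₂ : ℚ) → 0ℚ ≤ c₁ → c₁ ≤ 1ℚ → 0ℚ ≤ c₂ → c₂ ≤ 1ℚ →
    c₁ + c₂ < 1ℚ + 1ℚ →
    (m : ℕ) → (G : MixedGraph (suc m)) → IsMixed c₁ c₂ G →
    Log43≤ (suc m)
      ((((1ℚ + 1ℚ) - c₁ - c₂) * toℚ (minDeg G) - toℚ (suc m)) * ½) →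
    OrientedDiamIs G 2
theorem2p1 c₁ c₂ _ _ _ _ _ ℕ.zero G _ (p , ↥x≡p , _) with trans (sym ↥x≡p) (↥-excess-single c₁ c₂ G)
... | ()
theorem2p1 c₁ c₂ _ c₁≤1 _ c₂≤1 _ (suc m) G mixed log = oriented-diameter-2 G λ u v _ →
  log-bound (excess c₁ c₂ G) (routes G u v (allFin _)) log (excess≤routes G c₁≤1 c₂≤1 mixed u v)
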